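{- Let $(G=(V,E),L,c,r,e_r)$ be a rooted WRAP instance and $\vec F\subseteq\mathrm{Shadows}(L)$ a non-shortenable directed WRAP solution. Then the sets $\mathcal R_{\vec F}(\vec\ell)$, $\vec\ell\in\vec F$, form a partition of $\mathcal C_G$; that is, every $C\in\mathcal C_G$ has exactly one link of $\vec F$ responsible for it.
   Context: Rooted WRAP instance: cycle $G=(V,E)$, links $L\subseteq\binom V2$, costs $c$, root $r$, edge $e_r\in E$ at $r$. $\mathcal C_G=\{C\subseteq V\setminus\{r\}:|\delta_E(C)|=2\}$. Directed link $(u,v)$ covers $C$ if $v\in C,u\notin C$; directed WRAP solution covers all $C\in\mathcal C_G$. Shortening of $(u,v)$: $(s,v)$, $s\ne v$, $s$ on the $u$-$v$ path of $(V,E\setminus\{e_r\})$ (strict if $s\ne u$); shadows of $\{u,v\}$: shortenings of $(u,v)$ or $(v,u)$. Non-shortenable: deleting or strictly shortening any link destroys feasibility; then $(V,\vec F)$ is an $r$-arborescence. $(u,v)\in\vec F$ is responsible for $C\in\mathcal C_G$ if $(u,v)$ covers $C$ and no link on the $r$-$u$ path in $(V,\vec F)$ covers $C$. $\mathcal R_{\vec F}(\vec\ell)=\{C\in\mathcal C_G:\vec\ell\text{ is responsible for }C\}$. -}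

module Defs where

open import Data.Nat using (ℕ; zero; suc; _+_; _∸_; _≤_; NonZero)
open import Data.Nat.DivMod using (_%_; m%n<n)
open import Data.Fin using (Fin; toℕ; fromℕ<)
open import Data.Bool using (Bool; true; false; if_then_else_)
open import Data.List using (allFin; map)
open import Data.Nat.ListAction using (sum)
open import Data.Product using (_×_; Σ; ∃; _,_)
open import Data.Sum using (_⊎_)
open import Data.Empty using (⊥)
open import Relation.Nullary using (¬_)
open import Relation.Binary.PropositionalEquality using (_≡_; _≢_)

-- The cycle G = (V, E): V = Fin n, and E = { {i , next i} : i ∈ Fin n }
-- (edge number i joins i and next i = i+1 mod n).  Requires n ≥ 3.
module _ (n : ℕ) .{{_ : NonZero n}} where

  next : Fin n → Fin n
  next i = fromℕ< (m%n<n (suc (toℕ i)) n)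

  VSet : Set
  VSet = Fin n → Bool

  differ : Bool → Bool → ℕ
  differ true  false = 1
  differ false true  = 1
  differ _     _     = 0

  cutSize : VSet → ℕ
  cutSize C = sum (map (λ i → differ (C i) (C (next i))) (allFin n))

  InCG : Fin n → VSet → Set
  InCG r C = (C r ≡ false) × (cutSize C ≡ 2)

  -- Position along the path (V, E ∖ {e_r}), where e_r is edge number eR
  -- (= {eR , next eR}); the path runs next eR , … , eR.
  pos : Fin n → Fin n → ℕ
  pos eR x = (toℕ x + (n ∸ suc (toℕ eR))) % n

  OnPath : Fin n → Fin n → Fin n → Fin n → Set
  OnPath eR u v s =
    (pos eR u ≤ pos eR s × pos eR s ≤ pos eR v) ⊎ (pos eR v ≤ pos eR s × pos eR s ≤ pos eR u)

  Shortening : Fin n → Fin n → Fin n → Fin n → Set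
  Shortening eR u v s = (s ≢ v) × OnPath eR u v s

  -- Links L (unordered pairs, given as a relation; {u,v} ∈ L iff L u v or L v u)
  LinkSet : Set₁
  LinkSet = Fin n → Fin n → Set

  ArcSet : Set₁
  ArcSet = Fin n → Fin n → Set

  Shadow : Fin n → LinkSet → Fin n → Fin n → Set
  Shadow eR L s v = ∃ λ u → (L u v ⊎ L v u) × Shortening eR u v s

  Covers : VSet → Fin n → Fin n → Set
  Covers C u v = (C v ≡ true) × (C u ≡ false)

  Feasible : Fin n → ArcSet → Set
  Feasible r F = ∀ C → InCG r C → Σ (Fin n) λ u → Σ (Fin n) λ v → F u v × Covers C u v

  deleteArc : ArcSet → Fin n → Fin n → ArcSet
  deleteArc F u v a b = F a b × ¬ ((a ≡ u) × (b ≡ v))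

  replaceArc : ArcSet → Fin n → Fin n → Fin n → ArcSet
  replaceArc F u v s a b = deleteArc F u v a b ⊎ ((a ≡ s) × (b ≡ v))

  NonShortenable : Fin n → Fin n → ArcSet → Set
  NonShortenable r eR F =
    Feasible r F
    × (∀ u v → F u v → ¬ Feasible r (deleteArc F u v))
    × (∀ u v s → F u v → s ≢ u → Shortening eR u v s → ¬ Feasible r (replaceArc F u v s))

  data Walk (F : ArcSet) : Fin n → Fin n → Set where
    []   : ∀ {x} → Walk F x x
    step : ∀ {x y z} → Walk F x y → F y z → Walk F x z

  SomeArcCovers : ∀ {F x y} → VSet → Walk F x y → Set
  SomeArcCovers C [] = ⊥
  SomeArcCovers C (step {y = y} {z = z} w _) = Covers C y z ⊎ SomeArcCovers C w

  Responsible : Fin n → ArcSet → VSet → Fin n → Fin n → Set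
  Responsible r F C u v =
    F u v × Covers C u v × (∀ (w : Walk F r u) → ¬ SomeArcCovers C w)

{-# OPTIONS --safe #-}
-- Number the vertices 0, …, N along the path (V, E ∖ {e_r}) starting at the root.  A vertex set avoiding
-- the root has exactly two boundary edges on the cycle iff its ranks form an interval [a , b] with
-- 1 ≤ a ≤ b ≤ N, so 𝒞_G is the set of these intervals.  Minimality gives each arc a private interval that
-- no other arc covers; the union of the private intervals of two arcs entering the same vertex would be left
-- uncovered, so every vertex other than r has exactly one parent.  Non-shortenability says that no arc
-- (x , y) strictly spans a vertex t whose root path avoids y, since (x , y) could then be shortened to
-- (t , y).  This excludes cycles, so (V, F) is an r-arborescence, and it shows that every C ∈ 𝒞_G has a
-- unique top: a vertex of C none of whose proper ancestors lies in C.  The links responsible for C are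
-- exactly the arcs entering a top of C.

module Submission where

open import Data.Bool using (Bool; true; false; _xor_; _∧_; if_then_else_)
import Data.Bool as Bool
open import Data.Bool.Properties using (∧-zeroʳ; ¬-not)
open import Data.Empty using (⊥; ⊥-elim)
open import Data.Fin using (Fin; toℕ; fromℕ<; opposite; _≟_)
import Data.Fin as Fin
open import Data.Fin.Permutation using (Permutation; permutation; _⟨$⟩ʳ_)
import Data.Fin.Properties as Finₚ
open import Data.List using (allFin; map; tabulate)
import Data.List.Properties as Listₚ
open import Data.Maybe using (Maybe; just; nothing)
import Data.Maybe.Properties as Maybeₚ
open import Data.Nat using (ℕ; zero; suc; _+_; _*_; _∸_; _≤_; _<_; _≤ᵇ_; z≤n; s≤s; z<s; _≤?_; _<?_; _⊓_; _⊔_; NonZero; >-nonZero)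
open import Data.Nat.DivMod using (_%_; m%n<n; %-distribˡ-+; m%n%n≡m%n; [m+n]%n≡m%n; m<n⇒m%n≡m)
open import Data.Nat.GeneralisedArithmetic using (iterate)
import Data.Nat.ListAction as List
open import Data.Nat.Properties hiding (_≟_)
open import Algebra.Properties.CommutativeMonoid.Sum +-0-commutativeMonoid
  using (sum; sum-syntax; sum-cong-≗; sum-permute)
open import Data.Product using (_×_; _,_; proj₁; proj₂; Σ; Σ-syntax; ∃-syntax)
import Data.Product.Properties as Productₚ
open import Data.Sum using (_⊎_; inj₁; inj₂; [_,_]′)
open import Function using (_∘_)
open import Relation.Binary using (tri<; tri≈; tri>)
open import Relation.Binary.PropositionalEquality
open import Relation.Nullary using (¬_; Dec; yes; no; does; contradiction)
open import Relation.Nullary.Decidable using (_×-dec_; _→-dec_; decidable-stable; dec-true; dec-false)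

open import Defs

-- Boolean sequences and their switches

switch : Bool → Bool → ℕ
switch x y = if x xor y then 1 else 0

switch-self : ∀ x → switch x x ≡ 0
switch-self true  = refl
switch-self false = refl

switch-≢ : ∀ {x y} → x ≢ y → switch x y ≡ 1
switch-≢ {true}  {true}  x≢y = ⊥-elim (x≢y refl)
switch-≢ {true}  {false} _   = refl
switch-≢ {false} {true}  _   = refl
switch-≢ {false} {false} x≢y = ⊥-elim (x≢y refl)

switch-comm : ∀ x y → switch x y ≡ switch y x
switch-comm true  true  = refl
switch-comm true  false = refl
switch-comm false true  = refl
switch-comm false false = refl

changes : (ℕ → Bool) → ℕ → ℕ
changes c k = ∑[ m < k ] switch (c (toℕ m)) (c (suc (toℕ m)))

changes-suc : ∀ c k → changes c (suc k) ≡ changes c k + switch (c k) (c (suc k))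
changes-suc c zero    = +-identityʳ (switch (c 0) (c 1))
changes-suc c (suc k) = begin
  switch (c 0) (c 1) + changes (c ∘ suc) (suc k)
    ≡⟨ cong (switch (c 0) (c 1) +_) (changes-suc (c ∘ suc) k) ⟩
  switch (c 0) (c 1) + (changes (c ∘ suc) k + switch (c (suc k)) (c (suc (suc k))))
    ≡⟨ +-assoc (switch (c 0) (c 1)) _ _ ⟨
  changes c (suc k) + switch (c (suc k)) (c (suc (suc k))) ∎
  where open ≡-Reasoning

changes-cong : ∀ {c d} k → (∀ m → m ≤ k → c m ≡ d m) → changes c k ≡ changes d k
changes-cong zero    c≗d = refl
changes-cong (suc k) c≗d =
  cong₂ _+_ (cong₂ switch (c≗d 0 z≤n) (c≗d 1 (s≤s z≤n)))
            (changes-cong k (λ m m≤k → c≗d (suc m) (s≤s m≤k)))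

changes-flat : ∀ {c b} k → (∀ m → m ≤ k → c m ≡ b) → changes c k ≡ 0
changes-flat zero    _    = refl
changes-flat {b = b} (suc k) c≡b =
  cong₂ _+_ (trans (cong₂ switch (c≡b 0 z≤n) (c≡b 1 (s≤s z≤n))) (switch-self b))
            (changes-flat k (λ m m≤k → c≡b (suc m) (s≤s m≤k)))

changes-mono : ∀ c {i j} → i ≤ j → changes c i ≤ changes c j
changes-mono c z≤n       = z≤n
changes-mono c (s≤s i≤j) = +-monoʳ-≤ (switch (c 0) (c 1)) (changes-mono (c ∘ suc) i≤j)

changes-pos : ∀ c j → c 0 ≢ c j → 0 < changes c j
changes-pos c zero    c0≢cj = ⊥-elim (c0≢cj refl)
changes-pos c (suc j) c0≢cj with c 0 Bool.≟ c 1
... | no  c0≢c1 = <-≤-trans (≤-reflexive (sym (switch-≢ c0≢c1))) (m≤m+n _ _)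
... | yes c0≡c1 = <-≤-trans (changes-pos (c ∘ suc) j (λ e → c0≢cj (trans c0≡c1 e))) (m≤n+m _ _)

changes-strict : ∀ c {i j} → i ≤ j → c i ≢ c j → changes c i < changes c j
changes-strict c {j = j} z≤n ci≢cj = changes-pos c j ci≢cj
changes-strict c (s≤s i≤j) ci≢cj = +-monoʳ-< (switch (c 0) (c 1)) (changes-strict (c ∘ suc) i≤j ci≢cj)

changes-reverse : ∀ c N → changes (λ m → c (N ∸ m)) N ≡ changes c N
changes-reverse c N = sym (trans (sum-permute switchAt reversal) (sum-cong-≗ reflected))
  where
  switchAt : Fin N → ℕ
  switchAt m = switch (c (toℕ m)) (c (suc (toℕ m)))

  reversal : Permutation N N
  reversal = permutation opposite opposite Finₚ.opposite-involutive Finₚ.opposite-involutive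

  reflected : ∀ m → switchAt (opposite m) ≡ switch (c (N ∸ toℕ m)) (c (N ∸ suc (toℕ m)))
  reflected m = begin
    switch (c (toℕ (opposite m))) (c (suc (toℕ (opposite m))))
      ≡⟨ cong (λ i → switch (c i) (c (suc i))) (Finₚ.opposite-prop m) ⟩
    switch (c (N ∸ suc (toℕ m))) (c (suc (N ∸ suc (toℕ m))))
      ≡⟨ cong (λ i → switch (c (N ∸ suc (toℕ m))) (c i)) (+-∸-assoc 1 (Finₚ.toℕ<n m)) ⟨
    switch (c (N ∸ suc (toℕ m))) (c (N ∸ toℕ m))
      ≡⟨ switch-comm (c (N ∸ suc (toℕ m))) (c (N ∸ toℕ m)) ⟩
    switch (c (N ∸ toℕ m)) (c (N ∸ suc (toℕ m))) ∎
    where open ≡-Reasoning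

cyclicChanges : (ℕ → Bool) → ℕ → ℕ
cyclicChanges c N = changes c N + switch (c N) (c 0)

cyclicChanges-periodic : ∀ c N → c (suc N) ≡ c 0 → cyclicChanges c N ≡ changes c (suc N)
cyclicChanges-periodic c N periodic =
  trans (cong (λ x → changes c N + switch (c N) x) (sym periodic)) (sym (changes-suc c N))

cyclicChanges-cong : ∀ {c d} N → (∀ m → m ≤ N → c m ≡ d m) → cyclicChanges c N ≡ cyclicChanges d N
cyclicChanges-cong N c≗d = cong₂ _+_ (changes-cong N c≗d) (cong₂ switch (c≗d N ≤-refl) (c≗d 0 z≤n))

does-true : ∀ {P : Set} (p : Dec P) → does p ≡ true → P
does-true (yes p) _ = p

does-false : ∀ {P : Set} (p : Dec P) → does p ≡ false → ¬ P
does-false (no ¬p) _ = ¬p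

interval : ℕ → ℕ → ℕ → Bool
interval a b m = does (a ≤? m) ∧ does (m ≤? b)

interval-∈ : ∀ {a b m} → a ≤ m → m ≤ b → interval a b m ≡ true
interval-∈ {a} {b} {m} a≤m m≤b = cong₂ _∧_ (dec-true (a ≤? m) a≤m) (dec-true (m ≤? b) m≤b)

interval-∉ : ∀ {a b m} → m < a ⊎ b < m → interval a b m ≡ false
interval-∉ {a} {b} {m} (inj₁ m<a) = cong (_∧ does (m ≤? b)) (dec-false (a ≤? m) (<⇒≱ m<a))
interval-∉ {a} {b} {m} (inj₂ b<m) =
  trans (cong (does (a ≤? m) ∧_) (dec-false (m ≤? b) (<⇒≱ b<m))) (∧-zeroʳ (does (a ≤? m)))

private
  does-∧-true : ∀ {P Q : Set} (p : Dec P) (q : Dec Q) → does p ∧ does q ≡ true → P × Q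
  does-∧-true (yes p) (yes q) _ = p , q

  does-∧-false : ∀ {P Q : Set} (p : Dec P) (q : Dec Q) → does p ∧ does q ≡ false → ¬ P ⊎ ¬ Q
  does-∧-false (no ¬p) _        _ = inj₁ ¬p
  does-∧-false (yes _) (no ¬q)  _ = inj₂ ¬q

interval-∈⁻ : ∀ {a b m} → interval a b m ≡ true → a ≤ m × m ≤ b
interval-∈⁻ {a} {b} {m} = does-∧-true (a ≤? m) (m ≤? b)

interval-∉⁻ : ∀ {a b m} → interval a b m ≡ false → m < a ⊎ b < m
interval-∉⁻ {a} {b} {m} eq with does-∧-false (a ≤? m) (m ≤? b) eq
... | inj₁ a≰m = inj₁ (≰⇒> a≰m)
... | inj₂ m≰b = inj₂ (≰⇒> m≰b)

private
  ≤ᵇ-suc : ∀ a m → (suc a ≤ᵇ suc m) ≡ (a ≤ᵇ m)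
  ≤ᵇ-suc zero    m = refl
  ≤ᵇ-suc (suc a) m = refl

interval-suc : ∀ a b m → interval a (suc b) (suc m) ≡ interval (a ∸ 1) b m
interval-suc zero    b m = cong (true ∧_) (≤ᵇ-suc m b)
interval-suc (suc a) b m = cong₂ _∧_ (≤ᵇ-suc a m) (≤ᵇ-suc m b)

changes-prefix : ∀ b k → b < k → changes (interval 0 b) k ≡ 1
changes-prefix zero    (suc k) _ =
  cong suc (changes-flat {interval 0 0 ∘ suc} k (λ m _ → interval-∉ {0} {0} {suc m} (inj₂ (s≤s z≤n))))
changes-prefix (suc b) (suc k) (s≤s b<k) =
  trans (changes-cong k (λ m _ → interval-suc 0 b m)) (changes-prefix b k b<k)

changes-interval : ∀ a b k → 1 ≤ a → a ≤ b → b < k → changes (interval a b) k ≡ 2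
changes-interval (suc zero) (suc b) (suc k) _ _ (s≤s b<k) =
  cong suc (trans (changes-cong k (λ m _ → interval-suc 1 b m)) (changes-prefix b k b<k))
changes-interval (suc (suc a)) (suc b) (suc k) _ (s≤s a≤b) (s≤s b<k) =
  trans (changes-cong k (λ m _ → interval-suc (suc (suc a)) b m))
        (changes-interval (suc a) b k (s≤s z≤n) a≤b b<k)

cyclicChanges-interval : ∀ {a b} N → 1 ≤ a → a ≤ b → b ≤ N → cyclicChanges (interval a b) N ≡ 2
cyclicChanges-interval {a} {b} N 1≤a a≤b b≤N =
  trans (cyclicChanges-periodic (interval a b) N wraps)
        (changes-interval a b (suc N) 1≤a a≤b (s≤s b≤N))
  where
  wraps : interval a b (suc N) ≡ interval a b 0
  wraps = trans (interval-∉ {a} {b} (inj₂ (s≤s b≤N))) (sym (interval-∉ {a} {b} (inj₁ 1≤a)))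

first-true-from : ∀ (c : ℕ → Bool) {k} N → k ≤ N →
  (∀ m → k ≤ m → m ≤ N → c m ≡ false) ⊎
  ∃[ j ] k ≤ j × j ≤ N × c j ≡ true × (∀ m → k ≤ m → m < j → c m ≡ false)
first-true-from c {k} N k≤N with c k in ck
... | true  = inj₂ (k , ≤-refl , k≤N , ck , λ m k≤m m<k → ⊥-elim (<⇒≱ m<k k≤m))
first-true-from c {k} zero z≤n | false = inj₁ λ { zero _ _ → ck }
first-true-from c {k} (suc N) k≤N | false with m≤n⇒m<n∨m≡n k≤N
... | inj₂ refl = inj₁ λ m k≤m m≤k → subst (λ x → c x ≡ false) (≤-antisym k≤m m≤k) ck
... | inj₁ k<1+N with first-true-from c N (≤-pred k<1+N)
...   | inj₂ (j , k≤j , j≤N , cj , before) = inj₂ (j , k≤j , m≤n⇒m≤1+n j≤N , cj , before)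
...   | inj₁ none with c (suc N) in cN
...     | true  = inj₂ (suc N , k≤N , ≤-refl , cN , λ m k≤m m≤N → none m k≤m (≤-pred m≤N))
...     | false = inj₁ λ m k≤m m≤1+N → [ (λ m<1+N → none m k≤m (≤-pred m<1+N))
                                        , (λ { refl → cN }) ]′ (m≤n⇒m<n∨m≡n m≤1+N)

last-true : ∀ (c : ℕ → Bool) {k} N → k ≤ N → c k ≡ true →
  ∃[ b ] k ≤ b × b ≤ N × c b ≡ true × (∀ m → b < m → m ≤ N → c m ≡ false)
last-true c {k} N k≤N ck with c N in cN
... | true = N , k≤N , ≤-refl , cN , λ m N<m m≤N → ⊥-elim (<⇒≱ N<m m≤N)
... | false with m≤n⇒m<n∨m≡n k≤N
...   | inj₂ refl = contradiction (trans (sym ck) cN) λ ()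
last-true c {k} (suc N) k≤N ck | false | inj₁ k<1+N
  with last-true c N (≤-pred k<1+N) ck
... | b , k≤b , b≤N , cb , after =
  b , k≤b , m≤n⇒m≤1+n b≤N , cb ,
  λ m b<m m≤1+N → [ (λ m<1+N → after m b<m (≤-pred m<1+N)) , (λ { refl → cN }) ]′ (m≤n⇒m<n∨m≡n m≤1+N)

-- A false value between the first and the last true one would force three switches.
cyclicChanges≡2⇒interval : ∀ c N → c 0 ≡ false → cyclicChanges c N ≡ 2 →
  ∃[ a ] ∃[ b ] (1 ≤ a × a ≤ b × b ≤ N) × (∀ m → m ≤ N → c m ≡ interval a b m)
cyclicChanges≡2⇒interval c N c0 two with first-true-from c {0} N z≤n
... | inj₁ none = contradiction (trans (sym two) no-changes) λ ()
  where
  no-changes : cyclicChanges c N ≡ 0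
  no-changes = cong₂ _+_ (changes-flat {c} N (λ m → none m z≤n)) (cong₂ switch (none N z≤n ≤-refl) c0)
... | inj₂ (a , _ , a≤N , ca , before) with last-true c N a≤N ca
... | b , a≤b , b≤N , cb , after = a , b , (1≤a , a≤b , b≤N) , pointwise
  where
  1≤a : 1 ≤ a
  1≤a = n≢0⇒n>0 λ { refl → contradiction (trans (sym ca) c0) λ () }

  pointwise : ∀ m → m ≤ N → c m ≡ interval a b m
  pointwise m m≤N with m <? a | b <? m
  ... | yes m<a | _       = trans (before m z≤n m<a) (sym (interval-∉ {a} {b} (inj₁ m<a)))
  ... | no _    | yes b<m = trans (after m b<m m≤N) (sym (interval-∉ {a} {b} (inj₂ b<m)))
  ... | no m≮a  | no b≮m  with c m in cm
  ...   | true  = sym (interval-∈ (≮⇒≥ m≮a) (≮⇒≥ b≮m))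
  ...   | false = ⊥-elim (<-irrefl refl (≤-trans three-changes (≤-reflexive two)))
    where
    rise : changes c 0 < changes c a
    rise = changes-strict c z≤n λ e → contradiction (trans (sym ca) (trans (sym e) c0)) λ ()
    fall : changes c a < changes c m
    fall = changes-strict c (≮⇒≥ m≮a) λ e → contradiction (trans (sym ca) (trans e cm)) λ ()
    rise′ : changes c m < changes c b
    rise′ = changes-strict c (≮⇒≥ b≮m) λ e → contradiction (trans (sym cb) (trans (sym e) cm)) λ ()
    three-changes : 3 ≤ cyclicChanges c N
    three-changes = ≤-trans (≤-trans (s≤s (≤-trans (s≤s rise) fall)) rise′)
                            (≤-trans (changes-mono c b≤N) (m≤m+n _ _))

interval-⊓⊔ˡ : ∀ {a₁ b₁ a₂ b₂ m} → interval a₁ b₁ m ≡ true → interval (a₁ ⊓ a₂) (b₁ ⊔ b₂) m ≡ true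
interval-⊓⊔ˡ {a₁} {b₁} {a₂} {b₂} m∈ with interval-∈⁻ {a₁} {b₁} m∈
... | a₁≤m , m≤b₁ = interval-∈ (≤-trans (m⊓n≤m a₁ a₂) a₁≤m) (≤-trans m≤b₁ (m≤m⊔n b₁ b₂))

interval-⊓⊔ʳ : ∀ {a₁ b₁ a₂ b₂ m} → interval a₂ b₂ m ≡ true → interval (a₁ ⊓ a₂) (b₁ ⊔ b₂) m ≡ true
interval-⊓⊔ʳ {a₁} {b₁} {a₂} {b₂} m∈ with interval-∈⁻ {a₂} {b₂} m∈
... | a₂≤m , m≤b₂ = interval-∈ (≤-trans (m⊓n≤n a₁ a₂) a₂≤m) (≤-trans m≤b₂ (m≤n⊔m b₁ b₂))

interval-⊓⊔⁻ : ∀ {a₁ b₁ a₂ b₂ p m} → interval a₁ b₁ p ≡ true → interval a₂ b₂ p ≡ true →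
  interval (a₁ ⊓ a₂) (b₁ ⊔ b₂) m ≡ true → interval a₁ b₁ m ≡ true ⊎ interval a₂ b₂ m ≡ true
interval-⊓⊔⁻ {a₁} {b₁} {a₂} {b₂} {p} {m} p∈₁ p∈₂ m∈
  with interval-∈⁻ {a₁} {b₁} p∈₁ | interval-∈⁻ {a₂} {b₂} p∈₂ | interval-∈⁻ {a₁ ⊓ a₂} {b₁ ⊔ b₂} m∈ | m ≤? p
... | a₁≤p , _ | a₂≤p , _ | ⊓≤m , m≤⊔ | no p≱m with ⊔-sel b₁ b₂
...   | inj₁ ⊔≡b₁ = inj₁ (interval-∈ (≤-trans a₁≤p (<⇒≤ (≰⇒> p≱m))) (subst (m ≤_) ⊔≡b₁ m≤⊔))
...   | inj₂ ⊔≡b₂ = inj₂ (interval-∈ (≤-trans a₂≤p (<⇒≤ (≰⇒> p≱m))) (subst (m ≤_) ⊔≡b₂ m≤⊔))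
interval-⊓⊔⁻ {a₁} {b₁} {a₂} {b₂} {p} {m} p∈₁ p∈₂ m∈
  | _ , p≤b₁ | _ , p≤b₂ | ⊓≤m , m≤⊔ | yes m≤p with ⊓-sel a₁ a₂
...   | inj₁ ⊓≡a₁ = inj₁ (interval-∈ (subst (_≤ m) ⊓≡a₁ ⊓≤m) (≤-trans m≤p p≤b₁))
...   | inj₂ ⊓≡a₂ = inj₂ (interval-∈ (subst (_≤ m) ⊓≡a₂ ⊓≤m) (≤-trans m≤p p≤b₂))

FalseRun : (ℕ → Bool) → ℕ → ℕ → Set
FalseRun c N p = ∃[ i ] ∃[ j ] i < p × p ≤ j × j ≤ N × c i ≡ true ×
                 (∀ m → i < m → m ≤ j → c m ≡ false) × (j ≡ N ⊎ (j < N × c (suc j) ≡ true))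

false-run : ∀ (c : ℕ → Bool) N {p} → p ≤ N → c 0 ≡ true → c p ≡ false → FalseRun c N p
false-run c N {p} p≤N c0 cp = left (last-true c p z≤n c0) (first-true-from c N p≤N)
  where
  glue : ∀ {i j} → (∀ m → i < m → m ≤ p → c m ≡ false) → (∀ m → p ≤ m → m ≤ j → c m ≡ false) →
         ∀ m → i < m → m ≤ j → c m ≡ false
  glue falseˡ falseʳ m i<m m≤j with m ≤? p
  ... | yes m≤p = falseˡ m i<m m≤p
  ... | no  m≰p = falseʳ m (<⇒≤ (≰⇒> m≰p)) m≤j

  left : ∃[ i ] 0 ≤ i × i ≤ p × c i ≡ true × (∀ m → i < m → m ≤ p → c m ≡ false) →
         (∀ m → p ≤ m → m ≤ N → c m ≡ false) ⊎
         ∃[ j ] p ≤ j × j ≤ N × c j ≡ true × (∀ m → p ≤ m → m < j → c m ≡ false) →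
         FalseRun c N p
  left (i , _ , i≤p , ci , falseˡ) (inj₁ none) =
    i , N , ≤∧≢⇒< i≤p (λ { refl → contradiction (trans (sym ci) cp) λ () }) , p≤N , ≤-refl , ci ,
    glue falseˡ none , inj₁ refl
  left (i , _ , i≤p , ci , falseˡ) (inj₂ (j′ , p≤j′ , j′≤N , cj′ , before)) with m≤n⇒m<n∨m≡n p≤j′
  ... | inj₂ refl = contradiction (trans (sym cj′) cp) λ ()
  ... | inj₁ (s≤s {n = j} p≤j) =
    i , j , i<p , p≤j , <⇒≤ j<N , ci , glue falseˡ (λ m p≤m m≤j → before m p≤m (s≤s m≤j)) ,
    inj₂ (j<N , cj′)
    where
    j<N : j < N
    j<N = j′≤N
    i<p : i < p
    i<p = ≤∧≢⇒< i≤p λ { refl → contradiction (trans (sym ci) cp) λ () }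

first-rise : ∀ (c : ℕ → Bool) {i} → 1 ≤ i → c 1 ≡ false → c i ≡ true →
  ∃[ j ] 1 ≤ j × j < i × c (suc j) ≡ true × (∀ m → 1 ≤ m → m ≤ j → c m ≡ false)
first-rise c {i} 1≤i c1 ci with first-true-from c i 1≤i
... | inj₁ none = contradiction (trans (sym ci) (none i 1≤i ≤-refl)) λ ()
... | inj₂ (suc zero , _ , _ , c1′ , _) = contradiction (trans (sym c1′) c1) λ ()
... | inj₂ (suc (suc j) , _ , 2+j≤i , c2+j , before) =
  suc j , s≤s z≤n , 2+j≤i , c2+j , λ m 1≤m m≤1+j → before m 1≤m (s≤s m≤1+j)

-- Cuts of the cycle as rank intervals

Between : ℕ → ℕ → ℕ → Set
Between i j k = (i ≤ j × j ≤ k) ⊎ (k ≤ j × j ≤ i)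

StrictlyBetween : ℕ → ℕ → ℕ → Set
StrictlyBetween i j k = (i < j × j < k) ⊎ (k < j × j < i)

-- rank x is the position of x on the path (V, E ∖ {e_r}) counted from the root end, vertexAt its inverse.
record PathNumbering (N : ℕ) (r eR : Fin (suc N)) : Set where
  field
    rank          : Fin (suc N) → ℕ
    vertexAt      : ℕ → Fin (suc N)
    rank≤N        : ∀ x → rank x ≤ N
    rank-vertexAt : ∀ {m} → m ≤ N → rank (vertexAt m) ≡ m
    vertexAt-rank : ∀ x → vertexAt (rank x) ≡ x
    rank-root     : rank r ≡ 0
    onPath        : ∀ {u v s} → Between (rank u) (rank s) (rank v) → OnPath (suc N) eR u v s
    cutSize≡cyclicChanges : ∀ C → cutSize (suc N) C ≡ cyclicChanges (C ∘ vertexAt) N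

sum-tabulate : ∀ {n} (f : Fin n → ℕ) → List.sum (tabulate f) ≡ sum f
sum-tabulate {zero}  f = refl
sum-tabulate {suc n} f = cong (f Fin.zero +_) (sum-tabulate (f ∘ Fin.suc))

[m%n+k]%n≡[m+k]%n : ∀ m k n .{{_ : NonZero n}} → (m % n + k) % n ≡ (m + k) % n
[m%n+k]%n≡[m+k]%n m k n = begin
  (m % n + k) % n           ≡⟨ %-distribˡ-+ (m % n) k n ⟩
  (m % n % n + k % n) % n   ≡⟨ cong (λ x → (x + k % n) % n) (m%n%n≡m%n m n) ⟩
  (m % n + k % n) % n       ≡⟨ %-distribˡ-+ m k n ⟨
  (m + k) % n               ∎
  where open ≡-Reasoning

differ≡switch : ∀ n .{{_ : NonZero n}} x y → differ n x y ≡ switch x y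
differ≡switch n true  true  = refl
differ≡switch n true  false = refl
differ≡switch n false true  = refl
differ≡switch n false false = refl

module AlongPath (N : ℕ) (eR : Fin (suc N)) where

  private
    e = toℕ eR

    e+1+gap≡n : suc e + (N ∸ e) ≡ suc N
    e+1+gap≡n = m+[n∸m]≡n (Finₚ.toℕ<n eR)

  position : Fin (suc N) → ℕ
  position = pos (suc N) eR

  pathVertex : ℕ → Fin (suc N)
  pathVertex m = fromℕ< (m%n<n (m + suc e) (suc N))

  toℕ-pathVertex : ∀ m → toℕ (pathVertex m) ≡ (m + suc e) % suc N
  toℕ-pathVertex m = Finₚ.toℕ-fromℕ< (m%n<n (m + suc e) (suc N))

  position<n : ∀ x → position x < suc N
  position<n x = m%n<n (toℕ x + (N ∸ e)) (suc N)

  position≤N : ∀ x → position x ≤ N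
  position≤N x = ≤-pred (position<n x)

  position-pathVertex : ∀ {m} → m ≤ N → position (pathVertex m) ≡ m
  position-pathVertex {m} m≤N = begin
    (toℕ (pathVertex m) + (N ∸ e)) % suc N     ≡⟨ cong (λ z → (z + (N ∸ e)) % suc N) (toℕ-pathVertex m) ⟩
    ((m + suc e) % suc N + (N ∸ e)) % suc N    ≡⟨ [m%n+k]%n≡[m+k]%n (m + suc e) (N ∸ e) (suc N) ⟩
    (m + suc e + (N ∸ e)) % suc N              ≡⟨ cong (_% suc N) (+-assoc m (suc e) (N ∸ e)) ⟩
    (m + (suc e + (N ∸ e))) % suc N            ≡⟨ cong (λ z → (m + z) % suc N) e+1+gap≡n ⟩
    (m + suc N) % suc N                        ≡⟨ [m+n]%n≡m%n m (suc N) ⟩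
    m % suc N                                  ≡⟨ m<n⇒m%n≡m (s≤s m≤N) ⟩
    m                                          ∎
    where open ≡-Reasoning

  pathVertex-position : ∀ x → pathVertex (position x) ≡ x
  pathVertex-position x = Finₚ.toℕ-injective (begin
    toℕ (pathVertex (position x))
      ≡⟨ toℕ-pathVertex (position x) ⟩
    ((toℕ x + (N ∸ e)) % suc N + suc e) % suc N
      ≡⟨ [m%n+k]%n≡[m+k]%n (toℕ x + (N ∸ e)) (suc e) (suc N) ⟩
    (toℕ x + (N ∸ e) + suc e) % suc N
      ≡⟨ cong (_% suc N) (+-assoc (toℕ x) (N ∸ e) (suc e)) ⟩
    (toℕ x + ((N ∸ e) + suc e)) % suc N
      ≡⟨ cong (λ z → (toℕ x + z) % suc N) (trans (+-comm (N ∸ e) (suc e)) e+1+gap≡n) ⟩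
    (toℕ x + suc N) % suc N
      ≡⟨ [m+n]%n≡m%n (toℕ x) (suc N) ⟩
    toℕ x % suc N
      ≡⟨ m<n⇒m%n≡m (Finₚ.toℕ<n x) ⟩
    toℕ x ∎)
    where open ≡-Reasoning

  next-pathVertex : ∀ m → next (suc N) (pathVertex m) ≡ pathVertex (suc m)
  next-pathVertex m = Finₚ.toℕ-injective (begin
    toℕ (next (suc N) (pathVertex m))          ≡⟨ Finₚ.toℕ-fromℕ< (m%n<n (suc (toℕ (pathVertex m))) (suc N)) ⟩
    suc (toℕ (pathVertex m)) % suc N           ≡⟨ cong (λ z → suc z % suc N) (toℕ-pathVertex m) ⟩
    (1 + (m + suc e) % suc N) % suc N          ≡⟨ cong (_% suc N) (+-comm 1 ((m + suc e) % suc N)) ⟩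
    ((m + suc e) % suc N + 1) % suc N          ≡⟨ [m%n+k]%n≡[m+k]%n (m + suc e) 1 (suc N) ⟩
    (m + suc e + 1) % suc N                    ≡⟨ cong (_% suc N) (+-comm (m + suc e) 1) ⟩
    (suc m + suc e) % suc N                    ≡⟨ toℕ-pathVertex (suc m) ⟨
    toℕ (pathVertex (suc m))                   ∎)
    where open ≡-Reasoning

  pathVertex-periodic : pathVertex (suc N) ≡ pathVertex 0
  pathVertex-periodic = Finₚ.toℕ-injective (begin
    toℕ (pathVertex (suc N))     ≡⟨ toℕ-pathVertex (suc N) ⟩
    (suc N + suc e) % suc N      ≡⟨ cong (_% suc N) (+-comm (suc N) (suc e)) ⟩
    (suc e + suc N) % suc N      ≡⟨ [m+n]%n≡m%n (suc e) (suc N) ⟩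
    suc e % suc N                ≡⟨ toℕ-pathVertex 0 ⟨
    toℕ (pathVertex 0)           ∎)
    where open ≡-Reasoning

  pathVertex-N : pathVertex N ≡ eR
  pathVertex-N = trans (cong pathVertex position-eR) (pathVertex-position eR)
    where
    position-eR : N ≡ position eR
    position-eR = sym (trans (cong (_% suc N) (m+[n∸m]≡n (Finₚ.toℕ≤pred[n] eR))) (m<n⇒m%n≡m ≤-refl))

  pathVertex-0 : pathVertex 0 ≡ next (suc N) eR
  pathVertex-0 = trans (sym pathVertex-periodic) (trans (sym (next-pathVertex N)) (cong (next (suc N)) pathVertex-N))

  pathOrder : Permutation (suc N) (suc N)
  pathOrder = permutation (pathVertex ∘ toℕ) (λ x → fromℕ< (position<n x))
    (λ x → trans (cong pathVertex (Finₚ.toℕ-fromℕ< (position<n x))) (pathVertex-position x))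
    (λ p → Finₚ.toℕ-injective (trans (Finₚ.toℕ-fromℕ< (position<n (pathVertex (toℕ p))))
                                      (position-pathVertex (Finₚ.toℕ≤pred[n] p))))

  cutSize≡changes : ∀ C → cutSize (suc N) C ≡ changes (C ∘ pathVertex) (suc N)
  cutSize≡changes C = begin
    List.sum (map edgeCut (allFin (suc N)))    ≡⟨ cong List.sum (Listₚ.map-tabulate (λ i → i) edgeCut) ⟩
    List.sum (tabulate edgeCut)               ≡⟨ sum-tabulate edgeCut ⟩
    sum edgeCut                               ≡⟨ sum-permute edgeCut pathOrder ⟩
    sum (edgeCut ∘ (pathOrder ⟨$⟩ʳ_))           ≡⟨ sum-cong-≗ {suc N} alongPath ⟩
    changes (C ∘ pathVertex) (suc N)          ∎
    where
    open ≡-Reasoning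
    edgeCut : Fin (suc N) → ℕ
    edgeCut i = differ (suc N) (C i) (C (next (suc N) i))
    alongPath : ∀ p → edgeCut (pathVertex (toℕ p)) ≡ switch (C (pathVertex (toℕ p))) (C (pathVertex (suc (toℕ p))))
    alongPath p = trans (differ≡switch (suc N) _ _)
                        (cong (λ v → switch (C (pathVertex (toℕ p))) (C v)) (next-pathVertex (toℕ p)))

  forwardNumbering : PathNumbering N (next (suc N) eR) eR
  forwardNumbering = record
    { rank          = position
    ; vertexAt      = pathVertex
    ; rank≤N        = position≤N
    ; rank-vertexAt = position-pathVertex
    ; vertexAt-rank = pathVertex-position
    ; rank-root     = trans (cong position (sym pathVertex-0)) (position-pathVertex z≤n)
    ; onPath        = λ between → between
    ; cutSize≡cyclicChanges = λ C →
        trans (cutSize≡changes C) (sym (cyclicChanges-periodic (C ∘ pathVertex) N (cong C pathVertex-periodic)))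
    }

  backwardNumbering : PathNumbering N eR eR
  backwardNumbering = record
    { rank          = λ x → N ∸ position x
    ; vertexAt      = λ m → pathVertex (N ∸ m)
    ; rank≤N        = λ x → m∸n≤m N (position x)
    ; rank-vertexAt = λ {m} m≤N → trans (cong (N ∸_) (position-pathVertex (m∸n≤m N m))) (m∸[m∸n]≡n m≤N)
    ; vertexAt-rank = λ x → trans (cong pathVertex (m∸[m∸n]≡n (position≤N x))) (pathVertex-position x)
    ; rank-root     = trans (cong (λ v → N ∸ position v) (sym pathVertex-N))
                            (trans (cong (N ∸_) (position-pathVertex {N} ≤-refl)) (n∸n≡0 N))
    ; onPath        = λ {u} {v} {s} → reversed {u} {v} {s}
    ; cutSize≡cyclicChanges = cut
    }
    where
    reflect : ∀ {a b} → N ∸ position a ≤ N ∸ position b → position b ≤ position a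
    reflect {a} {b} le = subst₂ _≤_ (m∸[m∸n]≡n (position≤N b)) (m∸[m∸n]≡n (position≤N a)) (∸-monoʳ-≤ N le)

    reversed : ∀ {u v s} → Between (N ∸ position u) (N ∸ position s) (N ∸ position v) → OnPath (suc N) eR u v s
    reversed {u} {v} {s} (inj₁ (us , sv)) = inj₂ (reflect {s} {v} sv , reflect {u} {s} us)
    reversed {u} {v} {s} (inj₂ (vs , su)) = inj₁ (reflect {s} {u} su , reflect {v} {s} vs)

    cut : ∀ C → cutSize (suc N) C ≡ cyclicChanges (λ m → C (pathVertex (N ∸ m))) N
    cut C = begin
      cutSize (suc N) C                              ≡⟨ cutSize≡changes C ⟩
      changes c (suc N)                              ≡⟨ changes-suc c N ⟩
      changes c N + switch (c N) (c (suc N))         ≡⟨ cong (λ x → changes c N + switch (c N) (C x)) pathVertex-periodic ⟩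
      changes c N + switch (c N) (c 0)               ≡⟨ cong₂ _+_ (changes-reverse c N) (switch-comm (c 0) (c N)) ⟨
      changes (λ m → c (N ∸ m)) N + switch (c 0) (c N) ≡⟨ cong (λ i → changes (λ m → c (N ∸ m)) N + switch (c i) (c N)) (n∸n≡0 N) ⟨
      cyclicChanges (λ m → c (N ∸ m)) N              ∎
      where
      open ≡-Reasoning
      c = C ∘ pathVertex

module Intervals {N : ℕ} {r eR : Fin (suc N)} (numbering : PathNumbering N r eR) where

  open PathNumbering numbering

  Iv : ℕ → ℕ → VSet (suc N)
  Iv a b x = interval a b (rank x)

  ProperInterval : ℕ → ℕ → Set
  ProperInterval a b = 1 ≤ a × a ≤ b × b ≤ N

  rank-injective : ∀ {x y} → rank x ≡ rank y → x ≡ y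
  rank-injective {x} {y} eq = trans (sym (vertexAt-rank x)) (trans (cong vertexAt eq) (vertexAt-rank y))

  vertexAt-0 : vertexAt 0 ≡ r
  vertexAt-0 = trans (cong vertexAt (sym rank-root)) (vertexAt-rank r)

  Iv-InCG : ∀ {a b} → ProperInterval a b → InCG (suc N) r (Iv a b)
  Iv-InCG {a} {b} (1≤a , a≤b , b≤N) =
    trans (cong (interval a b) rank-root) (interval-∉ {a} {b} (inj₁ 1≤a)) ,
    trans (cutSize≡cyclicChanges (Iv a b))
      (trans (cyclicChanges-cong N (λ m m≤N → cong (interval a b) (rank-vertexAt m≤N)))
             (cyclicChanges-interval N 1≤a a≤b b≤N))

  InCG⇒Iv : ∀ {C} → InCG (suc N) r C → ∃[ a ] ∃[ b ] ProperInterval a b × (∀ x → C x ≡ Iv a b x)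
  InCG⇒Iv {C} (Cr≡false , cut≡2) with
    cyclicChanges≡2⇒interval (C ∘ vertexAt) N (trans (cong C vertexAt-0) Cr≡false)
                             (trans (sym (cutSize≡cyclicChanges C)) cut≡2)
  ... | a , b , proper , agrees =
    a , b , proper , λ x → trans (cong C (sym (vertexAt-rank x))) (agrees (rank x) (rank≤N x))

-- Non-shortenable solutions form an arborescence

iterate-+ : ∀ {A : Set} (f : A → A) x a b → iterate f x (a + b) ≡ iterate f (iterate f x a) b
iterate-+ f x zero    b = refl
iterate-+ f x (suc a) b = iterate-+ f (f x) a b

iterate-suc : ∀ {A : Set} (f : A → A) x k → iterate f x (suc k) ≡ f (iterate f x k)
iterate-suc f x zero    = refl
iterate-suc f x (suc k) = iterate-suc f (f x) k

iterate-fixed : ∀ {A : Set} (f : A → A) {z} → f z ≡ z → ∀ k → iterate f z k ≡ z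
iterate-fixed f fz≡z zero    = refl
iterate-fixed f fz≡z (suc k) = trans (cong (λ y → iterate f y k) fz≡z) (iterate-fixed f fz≡z k)

iterate-cycle : ∀ {A : Set} (f : A → A) {y} d → iterate f y d ≡ y → ∀ t → iterate f y (t * d) ≡ y
iterate-cycle f d cycle zero    = refl
iterate-cycle f {y} d cycle (suc t) =
  trans (iterate-+ f y d (t * d)) (trans (cong (λ z → iterate f z (t * d)) cycle) (iterate-cycle f d cycle t))

module Arborescence {N : ℕ} {r eR : Fin (suc N)} (numbering : PathNumbering N r eR)
                    {F : ArcSet (suc N)} (nonShortenable : NonShortenable (suc N) r eR F) where

  open PathNumbering numbering
  open Intervals numbering

  private
    n = suc N

  feasible : Feasible n r F
  feasible = proj₁ nonShortenable

  inclusionwise-minimal : ∀ u v → F u v → ¬ Feasible n r (deleteArc n F u v)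
  inclusionwise-minimal = proj₁ (proj₂ nonShortenable)

  unshortenable : ∀ u v s → F u v → s ≢ u → Shortening n eR u v s → ¬ Feasible n r (replaceArc n F u v s)
  unshortenable = proj₂ (proj₂ nonShortenable)

  CoveredBy : ArcSet n → VSet n → Set
  CoveredBy G C = ∃[ c ] ∃[ d ] G c d × Covers n C c d

  coverIv : ∀ {a b} → ProperInterval a b → CoveredBy F (Iv a b)
  coverIv proper = feasible _ (Iv-InCG proper)

  covers-≗ : ∀ {C D} → (∀ x → C x ≡ D x) → ∀ {c d} → Covers n D c d → Covers n C c d
  covers-≗ C≗D {c} {d} (Dd , Dc) = trans (C≗D d) Dd , trans (C≗D c) Dc

  coveredBy-≗ : ∀ {G C D} → (∀ x → C x ≡ D x) → CoveredBy G D → CoveredBy G C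
  coveredBy-≗ C≗D (c , d , Gcd , covers) = c , d , Gcd , covers-≗ C≗D covers

  cover-avoiding : ∀ {u v} C → InCG n r C → ¬ Covers n C u v → CoveredBy (deleteArc n F u v) C
  cover-avoiding C C∈𝒞 ¬covers with feasible C C∈𝒞
  ... | c , d , Fcd , covers = c , d , (Fcd , λ { (refl , refl) → ¬covers covers }) , covers

  no-arc-enters-root : ∀ a → ¬ F a r
  no-arc-enters-root a Far = inclusionwise-minimal a r Far λ C C∈𝒞@(Cr , _) →
    cover-avoiding C C∈𝒞 λ (Cr≡true , _) → contradiction (trans (sym Cr≡true) Cr) λ ()

  ProperInterval? : ∀ a b → Dec (ProperInterval a b)
  ProperInterval? a b = (1 ≤? a) ×-dec ((a ≤? b) ×-dec (b ≤? N))

  IntervalIndices : VSet n → Set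
  IntervalIndices C = Σ[ i ∈ Fin n ] Σ[ j ∈ Fin n ] ProperInterval (toℕ i) (toℕ j) × (∀ x → C x ≡ Iv (toℕ i) (toℕ j) x)

  InCG⇒Iv-Fin : ∀ {C} → InCG n r C → IntervalIndices C
  InCG⇒Iv-Fin C∈𝒞 with InCG⇒Iv C∈𝒞
  ... | a , b , proper@(_ , a≤b , b≤N) , C≗Iv =
    fromℕ< a<n , fromℕ< b<n , subst₂ ProperInterval (sym toℕa) (sym toℕb) proper ,
    λ x → trans (C≗Iv x) (cong₂ (λ a′ b′ → Iv a′ b′ x) (sym toℕa) (sym toℕb))
    where
    a<n : a < n
    a<n = s≤s (≤-trans a≤b b≤N)
    b<n : b < n
    b<n = s≤s b≤N
    toℕa : toℕ (fromℕ< a<n) ≡ a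
    toℕa = Finₚ.toℕ-fromℕ< a<n
    toℕb : toℕ (fromℕ< b<n) ≡ b
    toℕb = Finₚ.toℕ-fromℕ< b<n

  chosenArc : Fin n → Fin n → Maybe (Fin n × Fin n)
  chosenArc i j with ProperInterval? (toℕ i) (toℕ j)
  ... | yes proper = just (proj₁ (coverIv proper) , proj₁ (proj₂ (coverIv proper)))
  ... | no  _      = nothing

  chosenArc-sound : ∀ i j {c d} → chosenArc i j ≡ just (c , d) → F c d
  chosenArc-sound i j eq with ProperInterval? (toℕ i) (toℕ j)
  chosenArc-sound i j refl | yes proper = proj₁ (proj₂ (proj₂ (coverIv proper)))

  chosenArc-covers : ∀ i j → ProperInterval (toℕ i) (toℕ j) →
    ∃[ c ] ∃[ d ] chosenArc i j ≡ just (c , d) × Covers n (Iv (toℕ i) (toℕ j)) c d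
  chosenArc-covers i j proper with ProperInterval? (toℕ i) (toℕ j)
  ... | yes proper′ = proj₁ (coverIv proper′) , proj₁ (proj₂ (coverIv proper′)) , refl ,
                      proj₂ (proj₂ (proj₂ (coverIv proper′)))
  ... | no  ¬proper = contradiction proper ¬proper

  private
    _≟ᵃ_ : (p q : Maybe (Fin n × Fin n)) → Dec (p ≡ q)
    _≟ᵃ_ = Maybeₚ.≡-dec (Productₚ.≡-dec _≟_ _≟_)

  -- Minimality forces every arc to be the chosen cover of some interval, which is a finite search.
  arc? : ∀ u v → Dec (F u v)
  arc? u v with Finₚ.any? (λ i → Finₚ.any? (λ j → chosenArc i j ≟ᵃ just (u , v)))
  ... | yes (i , j , chosen) = yes (chosenArc-sound i j chosen)
  ... | no  never = no λ Fuv → inclusionwise-minimal u v Fuv λ C C∈𝒞 → byChoice C (InCG⇒Iv-Fin C∈𝒞)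
    where
    byChoice : ∀ C → IntervalIndices C → CoveredBy (deleteArc n F u v) C
    byChoice C (i , j , proper , C≗Iv) with chosenArc-covers i j proper
    ... | c , d , chosen , covers =
      c , d , (chosenArc-sound i j chosen , λ { (refl , refl) → never (i , j , chosen) }) , covers-≗ C≗Iv covers

  covers? : ∀ C u v → Dec (Covers n C u v)
  covers? C u v = (C v Bool.≟ true) ×-dec (C u Bool.≟ false)

  OnlyVia : Fin n → Fin n → VSet n → Fin n → Fin n → Set
  OnlyVia u v C c d = F c d → Covers n C c d → c ≡ u × d ≡ v

  onlyVia? : ∀ u v C c d → Dec (OnlyVia u v C c d)
  onlyVia? u v C c d = arc? c d →-dec (covers? C c d →-dec ((c ≟ u) ×-dec (d ≟ v)))

  OnlyCoveredBy : Fin n → Fin n → VSet n → Set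
  OnlyCoveredBy u v C = ∀ c d → OnlyVia u v C c d

  onlyCoveredBy? : ∀ u v C → Dec (OnlyCoveredBy u v C)
  onlyCoveredBy? u v C = Finₚ.all? λ c → Finₚ.all? (onlyVia? u v C c)

  PrivateInterval : Fin n → Fin n → ℕ → ℕ → Set
  PrivateInterval u v a b = ProperInterval a b × Covers n (Iv a b) u v × OnlyCoveredBy u v (Iv a b)

  other-cover : ∀ {u v} C → ¬ OnlyCoveredBy u v C → CoveredBy (deleteArc n F u v) C
  other-cover {u} {v} C notOnly
    with Finₚ.¬∀⟶∃¬ n _ (λ c → Finₚ.all? (onlyVia? u v C c)) notOnly
  ... | c , ¬∀d with Finₚ.¬∀⟶∃¬ n _ (onlyVia? u v C c) ¬∀d
  ...   | d , ¬implication = pick (arc? c d) (covers? C c d)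
    where
    pick : Dec (F c d) → Dec (Covers n C c d) → CoveredBy (deleteArc n F u v) C
    pick (yes Fcd) (yes covers) = c , d , (Fcd , λ eq → ¬implication λ _ _ → eq) , covers
    pick (yes _)   (no ¬covers) = contradiction (λ _ covers → contradiction covers ¬covers) ¬implication
    pick (no ¬Fcd) _            = contradiction (λ Fcd → contradiction Fcd ¬Fcd) ¬implication

  privateInterval? : ∀ u v (i j : Fin n) → Dec (PrivateInterval u v (toℕ i) (toℕ j))
  privateInterval? u v i j =
    ProperInterval? (toℕ i) (toℕ j) ×-dec (covers? (Iv (toℕ i) (toℕ j)) u v ×-dec onlyCoveredBy? u v (Iv (toℕ i) (toℕ j)))

  private-interval : ∀ {u v} → F u v → ∃[ a ] ∃[ b ] PrivateInterval u v a b
  private-interval {u} {v} Fuv with Finₚ.any? (λ i → Finₚ.any? (privateInterval? u v i))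
  ... | yes (i , j , private′) = toℕ i , toℕ j , private′
  ... | no  none = contradiction (λ C C∈𝒞 → byOther C C∈𝒞 (InCG⇒Iv-Fin C∈𝒞)) (inclusionwise-minimal u v Fuv)
    where
    byOther : ∀ C → InCG n r C → IntervalIndices C → CoveredBy (deleteArc n F u v) C
    byOther C C∈𝒞 (i , j , proper , C≗Iv) with covers? C u v
    ... | no  ¬covers = cover-avoiding C C∈𝒞 ¬covers
    ... | yes covers = coveredBy-≗ C≗Iv (other-cover (Iv (toℕ i) (toℕ j)) notOnly)
      where
      notOnly : ¬ OnlyCoveredBy u v (Iv (toℕ i) (toℕ j))
      notOnly only = none (i , j , proper , covers-≗ (λ x → sym (C≗Iv x)) covers , only)

  tail-in-private : ∀ {u v w a b} → PrivateInterval u v a b → F w v → w ≢ u → Iv a b w ≡ true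
  tail-in-private (_ , (v∈ , _) , only) Fwv w≢u = ¬-not {y = false} λ w∉ → w≢u (proj₁ (only _ _ Fwv (v∈ , w∉)))

  proper-⊓⊔ : ∀ {a₁ b₁ a₂ b₂} → ProperInterval a₁ b₁ → ProperInterval a₂ b₂ → ProperInterval (a₁ ⊓ a₂) (b₁ ⊔ b₂)
  proper-⊓⊔ {a₁} {b₁} {a₂} {b₂} (1≤a₁ , a₁≤b₁ , b₁≤N) (1≤a₂ , _ , b₂≤N) =
    ⊓-glb 1≤a₁ 1≤a₂ , ≤-trans (m⊓n≤m a₁ a₂) (≤-trans a₁≤b₁ (m≤m⊔n b₁ b₂)) , ⊔-lub b₁≤N b₂≤N

  -- The union of the private intervals of (a , v) and (b , v) is in 𝒞_G, and its cover can be neither arc.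
  in-arc-unique : ∀ {a b v} → F a v → F b v → a ≡ b
  in-arc-unique {a} {b} {v} Fav Fbv =
    decidable-stable (a ≟ b) λ a≢b → distinct a≢b (private-interval Fav) (private-interval Fbv)
    where
    distinct : a ≢ b → ∃[ a₁ ] ∃[ b₁ ] PrivateInterval a v a₁ b₁ → ∃[ a₂ ] ∃[ b₂ ] PrivateInterval b v a₂ b₂ → ⊥
    distinct a≢b (a₁ , b₁ , private₁@(proper₁ , (v∈₁ , _) , only₁)) (a₂ , b₂ , private₂@(proper₂ , (v∈₂ , _) , only₂))
      with coverIv (proper-⊓⊔ proper₁ proper₂)
    ... | c , d , Fcd , d∈ , c∉ = [ via₁ , via₂ ]′ (interval-⊓⊔⁻ {a₁} {b₁} {a₂} {b₂} v∈₁ v∈₂ d∈)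
      where
      outside : ∀ {x} → Iv a₁ b₁ x ≡ true ⊎ Iv a₂ b₂ x ≡ true → Iv (a₁ ⊓ a₂) (b₁ ⊔ b₂) x ≡ true
      outside (inj₁ x∈₁) = interval-⊓⊔ˡ {a₁} {b₁} {a₂} {b₂} x∈₁
      outside (inj₂ x∈₂) = interval-⊓⊔ʳ {a₁} {b₁} {a₂} {b₂} x∈₂

      c∉ᵢ : ∀ {a′ b′} → (Iv a′ b′ c ≡ true → Iv a₁ b₁ c ≡ true ⊎ Iv a₂ b₂ c ≡ true) → Iv a′ b′ c ≡ false
      c∉ᵢ into = ¬-not {y = true} λ c∈ → contradiction (trans (sym (outside (into c∈))) c∉) λ ()

      via₁ : Iv a₁ b₁ d ≡ true → ⊥
      via₁ d∈₁ with only₁ c d Fcd (d∈₁ , c∉ᵢ {a₁} {b₁} inj₁)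
      ... | refl , _ = contradiction (trans (sym (outside (inj₂ (tail-in-private private₂ Fav a≢b)))) c∉) λ ()

      via₂ : Iv a₂ b₂ d ≡ true → ⊥
      via₂ d∈₂ with only₂ c d Fcd (d∈₂ , c∉ᵢ {a₂} {b₂} inj₂)
      ... | refl , _ = contradiction (trans (sym (outside (inj₁ (tail-in-private private₁ Fbv (a≢b ∘ sym))))) c∉) λ ()

  arc-into : ∀ {v} → v ≢ r → ∃[ c ] F c v
  arc-into {v} v≢r with coverIv {rank v} {rank v} (1≤rank , ≤-refl , rank≤N v)
    where
    1≤rank : 1 ≤ rank v
    1≤rank = n≢0⇒n>0 λ rank≡0 → v≢r (rank-injective (trans rank≡0 (sym rank-root)))
  ... | c , d , Fcd , d∈ , _ with interval-∈⁻ {rank v} {rank v} d∈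
  ... | lo , hi = c , subst (F c) (rank-injective (≤-antisym hi lo)) Fcd

  parent : Fin n → Fin n
  parent v with v ≟ r
  ... | yes _   = r
  ... | no  v≢r = proj₁ (arc-into v≢r)

  parent-arc : ∀ {v} → v ≢ r → F (parent v) v
  parent-arc {v} v≢r with v ≟ r
  ... | yes v≡r  = contradiction v≡r v≢r
  ... | no  v≢r′ = proj₂ (arc-into v≢r′)

  parent-root : parent r ≡ r
  parent-root with r ≟ r
  ... | yes _   = refl
  ... | no  r≢r = contradiction refl r≢r

  arc⇒parent : ∀ {a v} → F a v → a ≡ parent v
  arc⇒parent {a} {v} Fav with v ≟ r
  ... | yes refl = contradiction Fav (no-arc-enters-root a)
  ... | no  v≢r  = in-arc-unique Fav (proj₂ (arc-into v≢r))

  infixl 8 _↑_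
  _↑_ : Fin n → ℕ → Fin n
  x ↑ k = iterate parent x k

  root↑ : ∀ k → r ↑ k ≡ r
  root↑ = iterate-fixed parent parent-root

  Rooted : Fin n → Set
  Rooted x = x ↑ n ≡ r

  reaches-beyond : ∀ {x k m} → x ↑ k ≡ r → k ≤ m → x ↑ m ≡ r
  reaches-beyond {x} {k} {m} x↑k≡r k≤m = begin
    x ↑ m                ≡⟨ cong (x ↑_) (m+[n∸m]≡n k≤m) ⟨
    x ↑ (k + (m ∸ k))    ≡⟨ iterate-+ parent x k (m ∸ k) ⟩
    x ↑ k ↑ (m ∸ k)      ≡⟨ cong (_↑ (m ∸ k)) x↑k≡r ⟩
    r ↑ (m ∸ k)          ≡⟨ root↑ (m ∸ k) ⟩
    r                    ∎
    where open ≡-Reasoning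

  -- By pigeonhole the walk x, x ↑ 1, …, x ↑ n repeats; past that point it cycles, so it must sit at r.
  reaches⇒rooted : ∀ {x k} → x ↑ k ≡ r → Rooted x
  reaches⇒rooted {x} {k} x↑k≡r with Finₚ.pigeonhole ≤-refl (λ (i : Fin (suc n)) → x ↑ toℕ i)
  ... | i , j , i<j , repeat = begin
    x ↑ n                                  ≡⟨ cong (x ↑_) (m+[n∸m]≡n I≤n) ⟨
    x ↑ (I + (n ∸ I))                      ≡⟨ iterate-+ parent x I (n ∸ I) ⟩
    x ↑ I ↑ (n ∸ I)                        ≡⟨ cong (_↑ (n ∸ I)) (iterate-cycle parent d cycle k) ⟨
    x ↑ I ↑ (k * d) ↑ (n ∸ I)              ≡⟨ cong (_↑ (n ∸ I)) (iterate-+ parent x I (k * d)) ⟨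
    x ↑ (I + k * d) ↑ (n ∸ I)              ≡⟨ iterate-+ parent x (I + k * d) (n ∸ I) ⟨
    x ↑ (I + k * d + (n ∸ I))              ≡⟨ reaches-beyond x↑k≡r k≤ ⟩
    r                                      ∎
    where
    open ≡-Reasoning
    I = toℕ i
    d = toℕ j ∸ I
    I<J : I < toℕ j
    I<J = Finₚ.toℕ-mono-< i<j
    I≤n : I ≤ n
    I≤n = <⇒≤ (<-≤-trans I<J (≤-pred (Finₚ.toℕ<n j)))
    cycle : x ↑ I ↑ d ≡ x ↑ I
    cycle = trans (sym (iterate-+ parent x I d)) (trans (cong (x ↑_) (m+[n∸m]≡n (<⇒≤ I<J))) (sym repeat))
    k≤ : k ≤ I + k * d + (n ∸ I)
    k≤ = ≤-trans (≤-trans (m≤m*n k d {{>-nonZero (m<n⇒0<n∸m I<J)}}) (m≤n+m (k * d) I)) (m≤m+n _ _)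

  rooted-parent : ∀ {x} → Rooted (parent x) → Rooted x
  rooted-parent {x} = reaches⇒rooted {x} {suc n}

  rooted-↑ : ∀ {x} k → Rooted x → Rooted (x ↑ k)
  rooted-↑ {x} k rooted = trans (sym (iterate-+ parent x k n)) (reaches-beyond rooted (m≤n+m n k))

  Ancestor : Fin n → Fin n → Set
  Ancestor y t = ∃[ k ] t ↑ k ≡ y

  Top : VSet n → Fin n → Set
  Top C v = C v ≡ true × (∀ k → C (v ↑ suc k) ≡ false)

  top-above : ∀ {C t} → C r ≡ false → C t ≡ true → Rooted t → ∃[ j ] Top C (t ↑ j)
  top-above {C} {t} Cr Ct rooted = lastInside (last-true (λ k → C (t ↑ k)) n z≤n Ct)
    where
    lastInside : ∃[ b ] 0 ≤ b × b ≤ n × C (t ↑ b) ≡ true × (∀ m → b < m → m ≤ n → C (t ↑ m) ≡ false) →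
                 ∃[ j ] Top C (t ↑ j)
    lastInside (b , _ , _ , Ctb , after) = b , Ctb , above
      where
      above : ∀ k → C (t ↑ b ↑ suc k) ≡ false
      above k with b + suc k ≤? n
      ... | yes ≤n = subst (λ z → C z ≡ false) (iterate-+ parent t b (suc k)) (after (b + suc k) (m<m+n b z<s) ≤n)
      ... | no  ≰n =
        trans (cong C (trans (sym (iterate-+ parent t b (suc k))) (reaches-beyond rooted (<⇒≤ (≰⇒> ≰n))))) Cr

  -- A cut that needed (x , y) but contains t is left by the top of t's root path inside it.
  shortcut-feasible : ∀ {x y t} → F x y → Rooted t → ¬ Ancestor y t → Feasible n r (replaceArc n F x y t)
  shortcut-feasible {x} {y} {t} Fxy rooted unrelated D D∈𝒞@(Dr , _) = reroute (feasible D D∈𝒞)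
    where
    Rerouted : Set
    Rerouted = CoveredBy (replaceArc n F x y t) D

    viaTop : ∃[ j ] Top D (t ↑ j) → Rerouted
    viaTop (j , Dz , above) =
      parent (t ↑ j) , t ↑ j , inj₁ (parent-arc z≢r , λ (_ , z≡y) → unrelated (j , z≡y)) , Dz , above 0
      where
      z≢r : t ↑ j ≢ r
      z≢r z≡r = contradiction (trans (sym Dz) (trans (cong D z≡r) Dr)) λ ()

    viaShortening : D y ≡ true → ∀ b → D t ≡ b → Rerouted
    viaShortening Dy false Dt = t , y , inj₂ (refl , refl) , Dy , Dt
    viaShortening Dy true  Dt = viaTop (top-above {D} {t} Dr Dt rooted)

    reroute : CoveredBy F D → Rerouted
    reroute (c , d , Fcd , covers) with (c ≟ x) ×-dec (d ≟ y)
    ... | no  ≢xy           = c , d , inj₁ (Fcd , ≢xy) , covers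
    ... | yes (refl , refl) = viaShortening (proj₁ covers) (D t) refl

  spanned⇒¬¬ancestor : ∀ {x y t} → F x y → StrictlyBetween (rank x) (rank t) (rank y) → Rooted t → ¬ ¬ Ancestor y t
  spanned⇒¬¬ancestor {x} {y} {t} Fxy spanned rooted unrelated =
    unshortenable x y t Fxy (t≢x spanned) ((λ t≡y → unrelated (0 , t≡y)) , onPath {x} {y} {t} (weaken spanned))
      (shortcut-feasible Fxy rooted unrelated)
    where
    t≢x : StrictlyBetween (rank x) (rank t) (rank y) → t ≢ x
    t≢x (inj₁ (x<t , _)) refl = <-irrefl refl x<t
    t≢x (inj₂ (_ , t<x)) refl = <-irrefl refl t<x

    weaken : StrictlyBetween (rank x) (rank t) (rank y) → Between (rank x) (rank t) (rank y)
    weaken (inj₁ (x<t , t<y)) = inj₁ (<⇒≤ x<t , <⇒≤ t<y)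
    weaken (inj₂ (y<t , t<x)) = inj₂ (<⇒≤ y<t , <⇒≤ t<x)

  rooted? : ∀ x → Dec (Rooted x)
  rooted? x = x ↑ n ≟ r

  rootedAt : ℕ → Bool
  rootedAt m = does (rooted? (vertexAt m))

  rooted-at : ∀ {m} → rootedAt m ≡ true → Rooted (vertexAt m)
  rooted-at {m} = does-true (rooted? (vertexAt m))

  -- A maximal run of unrooted ranks is a cut; its cover (parent b , b) starts at an unrooted vertex
  -- outside the run, hence jumps over a rooted end of the run.
  no-unrooted-run : ∀ {p} → FalseRun rootedAt N p → ⊥
  no-unrooted-run {p} (i , j , i<p , p≤j , j≤N , rooted-i , unrooted-run , right-end) = jump (coverIv proper)
    where
    proper : ProperInterval (suc i) j
    proper = s≤s z≤n , ≤-trans i<p p≤j , j≤N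

    jump : CoveredBy F (Iv (suc i) j) → ⊥
    jump (a , b , Fab , b∈ , a∉) = side (interval-∉⁻ {suc i} {j} a∉) right-end
      where
      b-run : suc i ≤ rank b × rank b ≤ j
      b-run = interval-∈⁻ {suc i} {j} b∈

      ¬rooted-b : ¬ Rooted b
      ¬rooted-b = does-false (rooted? (vertexAt (rank b))) (unrooted-run (rank b) (proj₁ b-run) (proj₂ b-run))
                ∘ subst Rooted (sym (vertexAt-rank b))

      ¬rooted-a : ¬ Rooted a
      ¬rooted-a rooted-a = ¬rooted-b (rooted-parent {b} (subst Rooted (arc⇒parent Fab) rooted-a))

      a-not-at : ∀ {m} → rootedAt m ≡ true → rank a ≢ m
      a-not-at rooted-m refl = ¬rooted-a (subst Rooted (vertexAt-rank a) (rooted-at rooted-m))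

      jumps-over : ∀ {m} → m ≤ N → rootedAt m ≡ true → StrictlyBetween (rank a) m (rank b) → ⊥
      jumps-over {m} m≤N rooted-m spanned =
        spanned⇒¬¬ancestor {a} {b} {vertexAt m} Fab
          (subst (λ k → StrictlyBetween (rank a) k (rank b)) (sym (rank-vertexAt m≤N)) spanned)
          (rooted-at rooted-m)
          (λ (k , t↑k≡b) → ¬rooted-b (subst Rooted t↑k≡b (rooted-↑ k (rooted-at rooted-m))))

      side : rank a < suc i ⊎ j < rank a → j ≡ N ⊎ (j < N × rootedAt (suc j) ≡ true) → ⊥
      side (inj₁ a<1+i) _ with m≤n⇒m<n∨m≡n (≤-pred a<1+i)
      ... | inj₂ a≡i = a-not-at rooted-i a≡i
      ... | inj₁ a<i = jumps-over (≤-trans (<⇒≤ i<p) (≤-trans p≤j j≤N)) rooted-i (inj₁ (a<i , proj₁ b-run))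
      side (inj₂ j<a) (inj₁ j≡N) = <⇒≱ j<a (subst (rank a ≤_) (sym j≡N) (rank≤N a))
      side (inj₂ j<a) (inj₂ (j<N , rooted-1+j)) with m≤n⇒m<n∨m≡n j<a
      ... | inj₂ 1+j≡a = a-not-at rooted-1+j (sym 1+j≡a)
      ... | inj₁ 1+j<a = jumps-over j<N rooted-1+j (inj₂ (s≤s (proj₂ b-run) , 1+j<a))

  all-rooted : ∀ x → Rooted x
  all-rooted x = decidable-stable (rooted? x) λ ¬rooted →
    no-unrooted-run (false-run rootedAt N (rank≤N x) root-rooted (unrooted-rank ¬rooted))
    where
    root-rooted : rootedAt 0 ≡ true
    root-rooted = dec-true (rooted? (vertexAt 0)) (subst Rooted (sym vertexAt-0) (root↑ n))

    unrooted-rank : ¬ Rooted x → rootedAt (rank x) ≡ false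
    unrooted-rank ¬rooted = dec-false (rooted? (vertexAt (rank x))) (¬rooted ∘ subst Rooted (vertexAt-rank x))

  ancestor? : ∀ y t → Dec (Ancestor y t)
  ancestor? y t with Finₚ.any? (λ (k : Fin (suc n)) → t ↑ toℕ k ≟ y)
  ... | yes (k , t↑k≡y) = yes (toℕ k , t↑k≡y)
  ... | no  none        = no within
    where
    within : ¬ Ancestor y t
    within (k , t↑k≡y) with k ≤? n
    ... | yes k≤n = none (fromℕ< (s≤s k≤n) , trans (cong (t ↑_) (Finₚ.toℕ-fromℕ< (s≤s k≤n))) t↑k≡y)
    ... | no  k≰n = none (fromℕ< (n<1+n n) , trans (cong (t ↑_) (Finₚ.toℕ-fromℕ< (n<1+n n)))
                          (trans (all-rooted t) (trans (sym (reaches-beyond (all-rooted t) (<⇒≤ (≰⇒> k≰n)))) t↑k≡y)))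

  spanned⇒ancestor : ∀ {x y t} → F x y → StrictlyBetween (rank x) (rank t) (rank y) → Ancestor y t
  spanned⇒ancestor {y = y} {t} Fxy spanned =
    decidable-stable (ancestor? y t) (spanned⇒¬¬ancestor Fxy spanned (all-rooted t))

  cycle⇒root : ∀ {y d} → 1 ≤ d → y ↑ d ≡ y → y ≡ r
  cycle⇒root {y} {d} 1≤d cycle =
    trans (sym (iterate-cycle parent d cycle n)) (reaches-beyond (all-rooted y) (m≤m*n n d {{>-nonZero 1≤d}}))

  ↑-returns : ∀ {x y p q} → p < q → x ↑ p ≡ y → x ↑ q ≡ y → y ↑ (q ∸ p) ≡ y
  ↑-returns {x} {y} {p} {q} p<q x↑p≡y x↑q≡y = begin
    y ↑ (q ∸ p)          ≡⟨ cong (_↑ (q ∸ p)) x↑p≡y ⟨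
    x ↑ p ↑ (q ∸ p)      ≡⟨ iterate-+ parent x p (q ∸ p) ⟨
    x ↑ (p + (q ∸ p))    ≡⟨ cong (x ↑_) (m+[n∸m]≡n (<⇒≤ p<q)) ⟩
    x ↑ q                ≡⟨ x↑q≡y ⟩
    y                    ∎
    where open ≡-Reasoning

  ↑-trans : ∀ {x y z a b} → x ↑ a ≡ y → y ↑ b ≡ z → x ↑ (a + b) ≡ z
  ↑-trans {x} {a = a} {b} x↑a≡y y↑b≡z = trans (iterate-+ parent x a b) (trans (cong (_↑ b) x↑a≡y) y↑b≡z)

  ↑-index-unique : ∀ {x y p q} → y ≢ r → x ↑ p ≡ y → x ↑ q ≡ y → p ≡ q
  ↑-index-unique {p = p} {q} y≢r x↑p≡y x↑q≡y with <-cmp p q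
  ... | tri≈ _ p≡q _ = p≡q
  ... | tri< p<q _ _ = contradiction (cycle⇒root (m<n⇒0<n∸m p<q) (↑-returns p<q x↑p≡y x↑q≡y)) y≢r
  ... | tri> _ _ q<p = contradiction (cycle⇒root (m<n⇒0<n∸m q<p) (↑-returns q<p x↑q≡y x↑p≡y)) y≢r

  top≢root : ∀ {C v} → C r ≡ false → Top C v → v ≢ r
  top≢root Cr (Cv , _) refl = contradiction (trans (sym Cv) Cr) λ ()

  top-not-below : ∀ {C w w′} → Top C w → C w′ ≡ true → w ≢ w′ → ¬ Ancestor w′ w
  top-not-below _ _ w≢w′ (zero , w≡w′) = w≢w′ w≡w′
  top-not-below {C} (_ , above) Cw′ _ (suc k , w↑≡w′) =
    contradiction (trans (sym (above k)) (trans (cong C w↑≡w′) Cw′)) λ ()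

  module TopsOf {α β} (proper : ProperInterval α β) where

    private
      1≤α = proj₁ proper
      α≤β = proj₁ (proj₂ proper)

    Left Right : Fin n → Set
    Left y  = rank y < α
    Right y = β < rank y

    root∉ : Iv α β r ≡ false
    root∉ = trans (cong (interval α β) rank-root) (interval-∉ {α} {β} (inj₁ 1≤α))

    left-unless-right : ∀ {y} → Iv α β y ≡ false → ¬ Right y → Left y
    left-unless-right y∉ ¬right with interval-∉⁻ {α} {β} y∉
    ... | inj₁ left  = left
    ... | inj₂ right = contradiction right ¬right

    right⇒≢r : ∀ {y} → Right y → y ≢ r
    right⇒≢r right refl = contradiction (subst (β <_) rank-root right) λ ()

    left-right-spans : ∀ {x y w} → F x y → Left x → Right y → Iv α β w ≡ true → Ancestor y w
    left-right-spans {w = w} Fxy left right w∈ with interval-∈⁻ {α} {β} w∈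
    ... | α≤w , w≤β = spanned⇒ancestor Fxy (inj₁ (<-≤-trans left α≤w , ≤-<-trans w≤β right))

    right-left-spans : ∀ {x y w} → F x y → Right x → Left y → Iv α β w ≡ true → Ancestor y w
    right-left-spans {w = w} Fxy right left w∈ with interval-∈⁻ {α} {β} w∈
    ... | α≤w , w≤β = spanned⇒ancestor Fxy (inj₂ (<-≤-trans left α≤w , ≤-<-trans w≤β right))

    exits-right : ∀ {v} → Top (Iv α β) v → Right (parent v) →
                  ∃[ J ] 1 ≤ J × (∀ m → 1 ≤ m → m ≤ J → Right (v ↑ m)) × Left (v ↑ suc J)
    exits-right {v} (_ , above) right =
      exit (first-rise atMostβ {n} (s≤s z≤n) (dec-false (rank (parent v) ≤? β) (<⇒≱ right))
                       (dec-true (rank (v ↑ n) ≤? β) (subst (λ w → rank w ≤ β) (sym (all-rooted v)) root≤β)))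
      where
      atMostβ : ℕ → Bool
      atMostβ k = does (rank (v ↑ k) ≤? β)

      root≤β : rank r ≤ β
      root≤β = subst (_≤ β) (sym rank-root) z≤n

      exit : ∃[ J ] 1 ≤ J × J < n × atMostβ (suc J) ≡ true × (∀ m → 1 ≤ m → m ≤ J → atMostβ m ≡ false) →
             ∃[ J ] 1 ≤ J × (∀ m → 1 ≤ m → m ≤ J → Right (v ↑ m)) × Left (v ↑ suc J)
      exit (J , 1≤J , _ , ≤β , before) =
        J , 1≤J , (λ m 1≤m m≤J → ≰⇒> (does-false (rank (v ↑ m) ≤? β) (before m 1≤m m≤J))) ,
        left-unless-right (above J) (≤⇒≯ (does-true (rank (v ↑ suc J) ≤? β) ≤β))

    enters-right : ∀ {v i} → Top (Iv α β) v → Left (parent v) → Right (v ↑ suc i) →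
                   ∃[ J ] 1 ≤ J × J ≤ i × Left (v ↑ J) × Right (v ↑ suc J)
    enters-right {v} {i} (_ , above) left right =
      entry (first-rise aboveβ {suc i} (s≤s z≤n) (dec-false (β <? rank (parent v)) (≤⇒≯ (≤-trans (<⇒≤ left) α≤β)))
                        (dec-true (β <? rank (v ↑ suc i)) right))
      where
      aboveβ : ℕ → Bool
      aboveβ k = does (β <? rank (v ↑ k))

      entry : ∃[ J ] 1 ≤ J × J < suc i × aboveβ (suc J) ≡ true × (∀ m → 1 ≤ m → m ≤ J → aboveβ m ≡ false) →
              ∃[ J ] 1 ≤ J × J ≤ i × Left (v ↑ J) × Right (v ↑ suc J)
      entry (suc J , 1≤J , J<1+i , >β , before) =
        suc J , 1≤J , ≤-pred J<1+i ,
        left-unless-right (above J) (does-false (β <? rank (v ↑ suc J)) (before (suc J) 1≤J ≤-refl)) ,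
        does-true (β <? rank (v ↑ suc (suc J))) >β

    right-run : ∀ {v J k g} → (∀ m → 1 ≤ m → m ≤ J → Right (v ↑ m)) → v ↑ J ≢ r →
                v ↑ (suc k + g) ≡ v ↑ J → Right (v ↑ suc k)
    right-run {k = k} {g} right-below z≢r reaches =
      right-below (suc k) (s≤s z≤n) (subst (suc k ≤_) (↑-index-unique z≢r reaches refl) (m≤m+n (suc k) g))

    -- The root path of v₂ first crosses to the left by an arc into some z; that arc spans v₁, so z is an
    -- ancestor of v₁.  On the way from v₁ up to z the path crosses to the right by an arc into some z′,
    -- which spans v₂; so z′ lies on v₂'s path strictly below z, where every vertex is right of the interval.
    crossing : ∀ {v₁ v₂} → Top (Iv α β) v₁ → Top (Iv α β) v₂ → Left (parent v₁) → Right (parent v₂) → ⊥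
    crossing {v₁} {v₂} top₁@(v₁∈ , _) top₂@(v₂∈ , _) left₁ right₂ = from-exit (exits-right top₂ right₂)
      where
      from-exit : ∃[ J ] 1 ≤ J × (∀ m → 1 ≤ m → m ≤ J → Right (v₂ ↑ m)) × Left (v₂ ↑ suc J) → ⊥
      from-exit (J , 1≤J , right-below , left-πz) =
        from-z (left-right-spans (parent-arc z≢r) (subst Left (iterate-suc parent v₂ J) left-πz) right-z v₁∈)
        where
        z = v₂ ↑ J
        right-z : Right z
        right-z = right-below J 1≤J ≤-refl
        z≢r : z ≢ r
        z≢r = right⇒≢r right-z

        from-entry : ∀ {i} → v₁ ↑ suc i ≡ z → ∃[ J′ ] 1 ≤ J′ × J′ ≤ i × Left (v₁ ↑ J′) × Right (v₁ ↑ suc J′) → ⊥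
        from-entry {i} v₁↑i≡z (J′ , _ , J′≤i , left-z′ , right-πz′) =
          below (right-left-spans (parent-arc z′≢r) right-πz′′ left-z′ v₂∈)
          where
          z′ = v₁ ↑ J′
          right-πz′′ : Right (parent z′)
          right-πz′′ = subst Right (iterate-suc parent v₁ J′) right-πz′
          z′≢r : z′ ≢ r
          z′≢r z′≡r = right⇒≢r right-πz′′ (trans (cong parent z′≡r) parent-root)
          z′-reaches-z : z′ ↑ (suc i ∸ J′) ≡ z
          z′-reaches-z = trans (sym (iterate-+ parent v₁ J′ (suc i ∸ J′)))
                               (trans (cong (v₁ ↑_) (m+[n∸m]≡n (m≤n⇒m≤1+n J′≤i))) v₁↑i≡z)

          below : Ancestor z′ v₂ → ⊥
          below (zero , v₂≡z′) = <⇒≱ left-z′ (subst (λ w → α ≤ rank w) v₂≡z′ (proj₁ (interval-∈⁻ {α} {β} v₂∈)))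
          below (suc k , v₂↑k≡z′) =
            <⇒≱ (right-run {v₂} {J} {k} {suc i ∸ J′} right-below z≢r (↑-trans {v₂} {a = suc k} v₂↑k≡z′ z′-reaches-z))
                (<⇒≤ (<-≤-trans (subst Left (sym v₂↑k≡z′) left-z′) α≤β))

        from-z : Ancestor z v₁ → ⊥
        from-z (zero , v₁≡z) = <⇒≱ right-z (subst (λ w → rank w ≤ β) v₁≡z (proj₂ (interval-∈⁻ {α} {β} v₁∈)))
        from-z (suc i , v₁↑i≡z) = from-entry v₁↑i≡z (enters-right {i = i} top₁ left₁ (subst Right (sym v₁↑i≡z) right-z))

    two-tops : ∀ {v₁ v₂} → Top (Iv α β) v₁ → Top (Iv α β) v₂ → rank v₁ < rank v₂ → ⊥
    two-tops {v₁} {v₂} top₁@(v₁∈ , above₁) top₂@(v₂∈ , above₂) v₁<v₂ =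
      cases (interval-∉⁻ {α} {β} (above₁ 0)) (interval-∉⁻ {α} {β} (above₂ 0))
      where
      v₁≢v₂ : v₁ ≢ v₂
      v₁≢v₂ refl = <-irrefl refl v₁<v₂

      cases : Left (parent v₁) ⊎ Right (parent v₁) → Left (parent v₂) ⊎ Right (parent v₂) → ⊥
      cases _ (inj₁ left₂) =
        top-not-below top₁ v₂∈ v₁≢v₂ (spanned⇒ancestor (parent-arc (top≢root root∉ top₂))
          (inj₁ (<-≤-trans left₂ (proj₁ (interval-∈⁻ {α} {β} v₁∈)) , v₁<v₂)))
      cases (inj₂ right₁) _ =
        top-not-below top₂ v₁∈ (v₁≢v₂ ∘ sym) (spanned⇒ancestor (parent-arc (top≢root root∉ top₁))
          (inj₂ (v₁<v₂ , ≤-<-trans (proj₂ (interval-∈⁻ {α} {β} v₂∈)) right₁)))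
      cases (inj₁ left₁) (inj₂ right₂) = crossing top₁ top₂ left₁ right₂

  Top-≗ : ∀ {C D v} → (∀ x → C x ≡ D x) → Top C v → Top D v
  Top-≗ C≗D (Cv , above) = trans (sym (C≗D _)) Cv , λ k → trans (sym (C≗D _)) (above k)

  top-unique : ∀ {C v₁ v₂} → InCG n r C → Top C v₁ → Top C v₂ → v₁ ≡ v₂
  top-unique {C} {v₁} {v₂} C∈𝒞 top₁ top₂ with InCG⇒Iv C∈𝒞
  ... | α , β , proper , C≗Iv with <-cmp (rank v₁) (rank v₂)
  ...   | tri< v₁<v₂ _ _ = ⊥-elim (TopsOf.two-tops proper (Top-≗ C≗Iv top₁) (Top-≗ C≗Iv top₂) v₁<v₂)
  ...   | tri≈ _ same _  = rank-injective same
  ...   | tri> _ _ v₂<v₁ = ⊥-elim (TopsOf.two-tops proper (Top-≗ C≗Iv top₂) (Top-≗ C≗Iv top₁) v₂<v₁)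

  walk : ∀ k x → x ↑ k ≡ r → Walk n F r x
  walk zero    x x≡r   = subst (Walk n F r) (sym x≡r) []
  walk (suc k) x reach = up (x ≟ r)
    where
    up : Dec (x ≡ r) → Walk n F r x
    up (yes x≡r) = subst (Walk n F r) (sym x≡r) []
    up (no  x≢r) = step (walk k (parent x) reach) (parent-arc x≢r)

  covering-walk : ∀ {C} → C r ≡ false → ∀ k x → x ↑ k ≡ r → ∀ j → C (x ↑ j) ≡ true →
                  Σ (Walk n F r x) (SomeArcCovers n C)
  covering-walk {C} Cr k x reach j Cx↑j = up k reach j Cx↑j (x ≟ r)
    where
    up : ∀ k → x ↑ k ≡ r → ∀ j → C (x ↑ j) ≡ true → Dec (x ≡ r) → Σ (Walk n F r x) (SomeArcCovers n C)
    up _ _ j Cx↑j (yes refl) = contradiction (trans (sym Cx↑j) (trans (cong C (root↑ j)) Cr)) λ ()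
    up zero x≡r _ _ (no x≢r) = contradiction x≡r x≢r
    up (suc k) reach (suc j) Cπx↑j (no x≢r) with covering-walk Cr k (parent x) reach j Cπx↑j
    ... | w , covered = step w (parent-arc x≢r) , inj₂ covered
    up (suc k) reach zero Cx (no x≢r) = viaParent (C (parent x)) refl
      where
      viaParent : ∀ b → C (parent x) ≡ b → Σ (Walk n F r x) (SomeArcCovers n C)
      viaParent false Cπx = step (walk k (parent x) reach) (parent-arc x≢r) , inj₁ (Cx , Cπx)
      viaParent true  Cπx with covering-walk Cr k (parent x) reach 0 Cπx
      ... | w , covered = step w (parent-arc x≢r) , inj₂ covered

  uncovered-walk : ∀ {C u} → (∀ k → C (u ↑ k) ≡ false) → (w : Walk n F r u) → ¬ SomeArcCovers n C w
  uncovered-walk outside (step w Fyu) (inj₁ (Cu , _)) = contradiction (trans (sym Cu) (outside 0)) λ ()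
  uncovered-walk {C} {u} outside (step {y = y} w Fyu) (inj₂ covered) =
    uncovered-walk (λ k → trans (cong (λ z → C (z ↑ k)) (arc⇒parent Fyu)) (outside (suc k))) w covered

  top⇒responsible : ∀ {C v} → C r ≡ false → Top C v → Responsible n r F C (parent v) v
  top⇒responsible Cr top@(Cv , above) =
    parent-arc (top≢root Cr top) , (Cv , above 0) , uncovered-walk above

  responsible⇒top : ∀ {C u v} → C r ≡ false → Responsible n r F C u v → u ≡ parent v × Top C v
  responsible⇒top {C} {u} {v} Cr (Fuv , (Cv , _) , uncovered) = arc⇒parent Fuv , Cv , above
    where
    above : ∀ k → C (v ↑ suc k) ≡ false
    above k = ¬-not {y = true} λ C↑ →
      let w , covered = covering-walk Cr n u (all-rooted u) k
                          (subst (λ z → C (z ↑ k) ≡ true) (sym (arc⇒parent Fuv)) C↑)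
      in uncovered w covered

  ExactlyOneResponsible : VSet n → Set
  ExactlyOneResponsible C = Σ (Fin n) λ u → Σ (Fin n) λ v → Responsible n r F C u v
    × (∀ u′ v′ → Responsible n r F C u′ v′ → (u′ ≡ u) × (v′ ≡ v))

  unique-responsible : ∀ C → InCG n r C → ExactlyOneResponsible C
  unique-responsible C C∈𝒞@(Cr , _) = fromInterval (InCG⇒Iv C∈𝒞)
    where
    fromTop : ∀ {v} → Top C v → ExactlyOneResponsible C
    fromTop {v} top = parent v , v , top⇒responsible Cr top , λ u′ v′ responsible →
      let u′≡πv′ , top′ = responsible⇒top Cr responsible
          v′≡v = top-unique C∈𝒞 top′ top
      in trans u′≡πv′ (cong parent v′≡v) , v′≡v

    fromInterval : ∃[ α ] ∃[ β ] ProperInterval α β × (∀ x → C x ≡ Iv α β x) → ExactlyOneResponsible C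
    fromInterval (α , β , (_ , α≤β , β≤N) , C≗Iv) =
      fromTop (proj₂ (top-above {C} {vertexAt α} Cr Cα (all-rooted (vertexAt α))))
      where
      Cα : C (vertexAt α) ≡ true
      Cα = trans (C≗Iv (vertexAt α))
                 (trans (cong (interval α β) (rank-vertexAt (≤-trans α≤β β≤N))) (interval-∈ ≤-refl α≤β))

lemma26 : (n : ℕ) .{{_ : NonZero n}} → 3 ≤ n →
    (L : LinkSet n) → (∀ u v → L u v → u ≢ v) →
    (r eR : Fin n) → (r ≡ eR ⊎ r ≡ next n eR) →
    (F : ArcSet n) → (∀ s v → F s v → Shadow n eR L s v) →
    NonShortenable n r eR F →
    ∀ C → InCG n r C →
      Σ (Fin n) λ u → Σ (Fin n) λ v → Responsible n r F C u v
        × (∀ u′ v′ → Responsible n r F C u′ v′ → (u′ ≡ u) × (v′ ≡ v))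
lemma26 zero () _ _ _ _ _ _ _ _ _
lemma26 (suc N) _ _ _ r eR (inj₁ refl) F _ nonShortenable =
  Arborescence.unique-responsible (AlongPath.backwardNumbering N eR) nonShortenable
lemma26 (suc N) _ _ _ r eR (inj₂ refl) F _ nonShortenable =
  Arborescence.unique-responsible (AlongPath.forwardNumbering N eR) nonShortenable
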